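{- Fix an integer $l\ge2$. Let $Z_{\mathrm{aux}}(M,N)$ be the weighted number of paths from $(0,0)$ to $(M,N)$ in the auxiliary model and $Z_U(M,N)$ the weighted number of paths from $(0,0)$ to $(M,N)$ in the model $\mathcal{L}_U$ (both described in the context). Then for every lattice point $(M,N)$ with $0\le M\le l-2$ we have $Z_U(M,N)=Z_{\mathrm{aux}}(M,N)$, and for every integer $k\ge1$ and every lattice point $(M,N)$ with $lk-1\le M\le l(k+1)-2$ and $N\ge 0$, $$Z_U(M,N)=\sum_{j=0}^{\left\lfloor\frac{N-lk+1}{2l}\right\rfloor}F^{(k-1+2j)}_{k-1}\,Z_{\mathrm{aux}}(M+2jl,N),$$ where $F^{(n)}_{m}=\binom{n}{\frac{n-m}{2}}-\binom{n}{\frac{n-m}{2}-1}$.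
   Context: Lattice: $\mathcal{L}=\{(x,y)\in\mathbb{Z}^2: x+y\equiv 0 \pmod 2\}$. A lattice path model is given by a set of allowed steps $(x,y)\to(x',y+1)$ between lattice points, each with a positive weight. A path from $(0,0)$ to $(M,N)$ is a sequence $P_0=(0,0),\dots,P_N=(M,N)$ of lattice points with each $P_i\to P_{i+1}$ an allowed step; its weight is the product of its step weights; the weighted number of paths is the sum of the weights of all such paths ($0$ if none). Auxiliary model (depending on $l$): Left wall at $x=0$: from $(0,y)$ the only step is $(0,y)\to(1,y+1)$, weight $1$. Filters of type 1 at $x=d$ for every $d=nl-1$, $n=1,2,\dots$: from $(d,y)$ the only step is $(d,y)\to(d+1,y+1)$, weight $1$; from $(d+1,y)$ the only steps are $(d+1,y)\to(d+2,y+1)$ with weight $1$ and $(d+1,y)\to(d,y+1)$ with weight $2$. From every other point $(x,y)$ the steps are $(x,y)\to(x\pm1,y+1)$, weight $1$. Model $\mathcal{L}_U$: all steps of the auxiliary model together with, for every integer $k\ge1$, the long steps $(l(k+2)-2,\,lk-2+2m)\to(lk-1,\,lk-1+2m)$, $m\ge0$, each of weight $1$. Binomial convention: $\binom{n}{x}=0$ unless $x$ is an integer with $0\le x\le n$. $\lfloor\cdot\rfloor$ denotes integer part. -}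

module Defs where

open import Data.Nat using (ℕ; zero; suc; _+_; _*_; _∸_; _≟_; _≤?_)
open import Data.Nat.DivMod using (_/_)
open import Data.Nat.Divisibility using (_∣?_)
open import Data.Nat.Combinatorics using (_C_)
open import Data.Integer as ℤ using (ℤ; +_; -[1+_])
open import Data.Bool using (Bool; true; false; if_then_else_; _∧_; not)
open import Relation.Nullary.Decidable using (⌊_⌋; yes; no)

sumℕ : ℕ → (ℕ → ℕ) → ℕ
sumℕ zero    f = 0
sumℕ (suc n) f = sumℕ n f + f n

sumℤ : ℕ → (ℕ → ℤ) → ℤ
sumℤ zero    f = + 0
sumℤ (suc n) f = sumℤ n f ℤ.+ f n

[_] : Bool → ℕ
[ true ]  = 1
[ false ] = 0

infix 4 _==_
_==_ : ℕ → ℕ → Bool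
m == n = ⌊ m ≟ n ⌋

-- Binomial coefficients with the convention binom n x = 0 unless
-- x is an integer with 0 ≤ x ≤ n  (stdlib's  n C k  is 0 for k > n).

binomℤ : ℕ → ℤ → ℤ
binomℤ n (+ x)    = + (n C x)
binomℤ n -[1+ _ ] = + 0

-- F^{(n)}_m = binom n ((n-m)/2) - binom n ((n-m)/2 - 1);
-- both binomials vanish unless (n-m)/2 is an integer with 0 ≤ (n-m)/2,
-- i.e. unless m ≤ n and n - m is even.
F : ℕ → ℕ → ℤ
F n m with m ≤? n | 2 ∣? (n ∸ m)
... | yes _ | yes _ =
        binomℤ n (+ h) ℤ.- binomℤ n (+ h ℤ.- + 1)
        where h = (n ∸ m) / 2
... | _ | _ = + 0

-- Step weights.  w x x' y  is the weight of the step (x,y) → (x',y+1)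
-- (0 if the step is not allowed).  Coordinates x are natural numbers:
-- every path starting at (0,0) stays in x ≥ 0 (left wall at x = 0).

-- x = n l - 1 for some n ≥ 1  (left point d of a type-1 filter)
isFilterD : ℕ → ℕ → Bool
isFilterD l x = ⌊ l ∣? suc x ⌋

-- x = n l for some n ≥ 1  (point d+1 of a type-1 filter)
isFilterD1 : ℕ → ℕ → Bool
isFilterD1 l x = not (x == 0) ∧ ⌊ l ∣? x ⌋

wAux : ℕ → ℕ → ℕ → ℕ → ℕ
wAux l zero x' y = [ x' == 1 ]
wAux l (suc x) x' y =
  if isFilterD l (suc x) then [ x' == suc (suc x) ]
  else if isFilterD1 l (suc x) then [ x' == suc (suc x) ] + 2 * [ x' == x ]
  else [ x' == suc (suc x) ] + [ x' == x ]

-- long steps (l(k+2)-2, lk-2+2m) → (lk-1, lk-1+2m), k ≥ 1, m ≥ 0, weight 1.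
-- Counted by bounded search over k ∈ [1, x] and m ∈ [0, y]
-- (necessarily k ≤ l(k+2)-2 = x and m ≤ lk-2+2m = y).
wLong : ℕ → ℕ → ℕ → ℕ → ℕ
wLong l x x' y =
  sumℕ x (λ k′ → let k = suc k′ in
    sumℕ (suc y) (λ m →
      [ x == l * (k + 2) ∸ 2 ] * [ y == l * k ∸ 2 + 2 * m ] * [ x' == l * k ∸ 1 ]))

wU : ℕ → ℕ → ℕ → ℕ → ℕ
wU l x x' y = wAux l x x' y + wLong l x x' y

-- At level y every reachable x
-- satisfies 0 ≤ x ≤ y (steps raise x by at most 1), so summing over
-- x ∈ [0, y] sums over all paths.

Zw : (ℕ → ℕ → ℕ → ℕ) → ℕ → ℕ → ℕ
Zw w M zero    = [ M == 0 ]
Zw w M (suc N) = sumℕ (suc N) (λ x → w x M N * Zw w x N)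

Zaux : ℕ → ℕ → ℕ → ℕ
Zaux l = Zw (wAux l)

ZU : ℕ → ℕ → ℕ → ℕ
ZU l = Zw (wU l)

floorDiv : ℕ → ℕ → ℕ
floorDiv a zero    = 0
floorDiv a (suc d) = a / suc d

{-# OPTIONS --safe #-}
-- Both path counts obey the transfer recurrence Z(M, N+1) = w(M) Z(M+1, N) + Z(M-1, N), where
-- w(M) ∈ {0, 1, 2} is the weight of the step M+1 → M; in ℒ_U the left end d = lk - 1 of a filter
-- also receives Z_U(d + 2l - 1, N) through a long step. Left of the first filter there are no long
-- steps, so Z_U = Z_aux there. For lk - 1 ≤ M ≤ l(k+1) - 2 the right-hand side
-- H_k(M, N) = Σ_j F^{(k-1+2j)}_{k-1} Z_aux(M + 2jl, N) obeys the same recurrence because w is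
-- l-periodic, and at M = d the ballot recurrence F^{(n+1)}_{m+1} = F^{(n)}_m + F^{(n)}_{m+2} splits
-- H_k(d - 1, N) into H_{k-1}(d - 1, N) + H_{k+1}(d + 2l - 1, N): the value Z_U(d - 1, N) plus exactly
-- the long-step contribution. Induction on N closes the argument; the terms with M + 2jl > N vanish.
module Submission where

open import Defs
open import Data.Bool using (Bool; true; false; if_then_else_)
open import Data.Empty using (⊥-elim)
open import Data.Integer as ℤ using (ℤ; +_)
import Data.Integer.Properties as ℤP
open import Data.Integer.Tactic.RingSolver using () renaming (solve-∀ to ℤ-solve-∀)
open import Data.Nat using (ℕ; zero; suc; pred; _+_; _*_; _∸_; _≤_; _<_; z≤n; s≤s; z<s; _≟_; _≤?_; _<?_)
open import Data.Nat.Properties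
open import Algebra.Properties.CommutativeSemigroup +-commutativeSemigroup
  using () renaming (interchange to +-interchange)
open import Algebra.Properties.CommutativeSemigroup ℤP.+-commutativeSemigroup
  using () renaming (interchange to ℤ+-interchange)
open import Data.Nat.Tactic.RingSolver using (solve-∀)
open import Data.Nat.Combinatorics using (_C_; nCk+nC[k+1]≡[n+1]C[k+1]; nCk≡nC[n∸k])
open import Data.Nat.DivMod using (_/_; m*n/n≡m; m≡m%n+[m/n]*n; m%n<n)
open import Data.Nat.Divisibility
  using (_∣_; _∣?_; divides; ∣m∣n⇒∣m+n; ∣m+n∣m⇒∣n; m∣m*n; n∣m*n; ∣-refl; ∣1⇒≡1)
open import Data.Product using (∃; _×_; _,_)
open import Data.Sum using (_⊎_; inj₁; inj₂)
open import Relation.Binary.Definitions using (tri<; tri≈; tri>)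
open import Relation.Binary.PropositionalEquality hiding ([_])
open import Relation.Nullary using (¬_; Dec; yes; no)
open import Relation.Nullary.Decidable using (isYes; isYes≗does; dec-true; dec-false)

isYes-true : ∀ {p} {A : Set p} (a? : Dec A) → A → isYes a? ≡ true
isYes-true a? a = trans (isYes≗does a?) (dec-true a? a)

isYes-false : ∀ {p} {A : Set p} (a? : Dec A) → ¬ A → isYes a? ≡ false
isYes-false a? ¬a = trans (isYes≗does a?) (dec-false a? ¬a)

≡⇒[==]≡1 : ∀ {a b} → a ≡ b → [ a == b ] ≡ 1
≡⇒[==]≡1 {a} {b} a≡b = cong [_] (isYes-true (a ≟ b) a≡b)

≢⇒[==]≡0 : ∀ {a b} → a ≢ b → [ a == b ] ≡ 0
≢⇒[==]≡0 {a} {b} a≢b = cong [_] (isYes-false (a ≟ b) a≢b)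

[==]-resp : ∀ {a b c d} → (a ≡ b → c ≡ d) → (c ≡ d → a ≡ b) → [ a == b ] ≡ [ c == d ]
[==]-resp {a} {b} {c} {d} to from with a ≟ b | c ≟ d
... | yes _   | yes _   = refl
... | no _    | no _    = refl
... | yes a≡b | no c≢d  = ⊥-elim (c≢d (to a≡b))
... | no a≢b  | yes c≡d = ⊥-elim (a≢b (from c≡d))

[==]-sym : ∀ a b → [ a == b ] ≡ [ b == a ]
[==]-sym a b = [==]-resp sym sym

[==]*-subst : ∀ x a (h : ℕ → ℕ) → [ x == a ] * h x ≡ [ x == a ] * h a
[==]*-subst x a h with x ≟ a
... | yes refl = refl
... | no _     = refl

sumℕ-cong : ∀ n {f g : ℕ → ℕ} → (∀ x → x < n → f x ≡ g x) → sumℕ n f ≡ sumℕ n g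
sumℕ-cong zero    f≗g = refl
sumℕ-cong (suc n) f≗g = cong₂ _+_ (sumℕ-cong n (λ x x<n → f≗g x (m<n⇒m<1+n x<n))) (f≗g n ≤-refl)

sumℕ-zero : ∀ n {f : ℕ → ℕ} → (∀ x → f x ≡ 0) → sumℕ n f ≡ 0
sumℕ-zero zero    f≗0 = refl
sumℕ-zero (suc n) f≗0 = cong₂ _+_ (sumℕ-zero n f≗0) (f≗0 n)

sumℕ-+ : ∀ n (f g : ℕ → ℕ) → sumℕ n (λ x → f x + g x) ≡ sumℕ n f + sumℕ n g
sumℕ-+ zero    f g = refl
sumℕ-+ (suc n) f g = begin
  sumℕ n (λ x → f x + g x) + (f n + g n) ≡⟨ cong (_+ (f n + g n)) (sumℕ-+ n f g) ⟩
  sumℕ n f + sumℕ n g + (f n + g n)      ≡⟨ +-interchange (sumℕ n f) (sumℕ n g) (f n) (g n) ⟩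
  sumℕ n f + f n + (sumℕ n g + g n)      ∎
  where open ≡-Reasoning

sumℕ-[==]*-out : ∀ n a (h : ℕ → ℕ) → n ≤ a → sumℕ n (λ x → [ x == a ] * h x) ≡ 0
sumℕ-[==]*-out n a h n≤a = trans
  (sumℕ-cong n (λ x x<n → cong (_* h x) (≢⇒[==]≡0 (λ x≡a → <-irrefl x≡a (<-≤-trans x<n n≤a)))))
  (sumℕ-zero n (λ _ → refl))

sumℕ-[==]* : ∀ n a (h : ℕ → ℕ) → a < n → sumℕ n (λ x → [ x == a ] * h x) ≡ h a
sumℕ-[==]* (suc n) a h a<1+n with n ≟ a
... | yes refl = cong₂ _+_ (sumℕ-[==]*-out n n h ≤-refl) (+-identityʳ (h n))
... | no n≢a   = trans (+-identityʳ _) (sumℕ-[==]* n a h (≤∧≢⇒< (m<1+n⇒m≤n a<1+n) (≢-sym n≢a)))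

atPred : (ℕ → ℕ) → ℕ → ℕ
atPred h zero    = 0
atPred h (suc M) = h M

sumℕ-[suc==]* : ∀ n M (h : ℕ → ℕ) → M ≤ n → sumℕ n (λ x → [ suc x == M ] * h x) ≡ atPred h M
sumℕ-[suc==]* n zero     h _   = sumℕ-zero n (λ _ → refl)
sumℕ-[suc==]* n (suc M') h M≤n = trans
  (sumℕ-cong n (λ x _ → cong (_* h x) ([==]-resp {suc x} {suc M'} suc-injective (cong suc))))
  (sumℕ-[==]* n M' h M≤n)

sumℕ-pad : ∀ n k (f : ℕ → ℕ) → (∀ x → n ≤ x → f x ≡ 0) → sumℕ (n + k) f ≡ sumℕ n f
sumℕ-pad n zero    f f≗0 = cong (λ m → sumℕ m f) (+-identityʳ n)
sumℕ-pad n (suc k) f f≗0 rewrite +-suc n k =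
  trans (cong₂ _+_ (sumℕ-pad n k f f≗0) (f≗0 (n + k) (m≤m+n n k))) (+-identityʳ _)

sumℕ-support : ∀ m n (f : ℕ → ℕ) →
  (∀ x → m ≤ x → f x ≡ 0) → (∀ x → n ≤ x → f x ≡ 0) → sumℕ m f ≡ sumℕ n f
sumℕ-support m n f f≗0₁ f≗0₂ = begin
  sumℕ m f       ≡⟨ sumℕ-pad m n f f≗0₁ ⟨
  sumℕ (m + n) f ≡⟨ cong (λ k → sumℕ k f) (+-comm m n) ⟩
  sumℕ (n + m) f ≡⟨ sumℕ-pad n m f f≗0₂ ⟩
  sumℕ n f       ∎
  where open ≡-Reasoning

sumℕ-nonzero : ∀ n (f : ℕ → ℕ) → sumℕ n f ≢ 0 → ∃ λ x → x < n × f x ≢ 0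
sumℕ-nonzero zero    f Σ≢0 = ⊥-elim (Σ≢0 refl)
sumℕ-nonzero (suc n) f Σ≢0 with f n ≟ 0
... | no fn≢0 = n , ≤-refl , fn≢0
... | yes fn≡0 with sumℕ-nonzero n f (λ Σ≡0 → Σ≢0 (cong₂ _+_ Σ≡0 fn≡0))
...   | x , x<n , fx≢0 = x , m<n⇒m<1+n x<n , fx≢0

sumℤ-cong : ∀ n {f g : ℕ → ℤ} → (∀ x → x < n → f x ≡ g x) → sumℤ n f ≡ sumℤ n g
sumℤ-cong zero    f≗g = refl
sumℤ-cong (suc n) f≗g = cong₂ ℤ._+_ (sumℤ-cong n (λ x x<n → f≗g x (m<n⇒m<1+n x<n))) (f≗g n ≤-refl)

sumℤ-zero : ∀ n {f : ℕ → ℤ} → (∀ x → f x ≡ + 0) → sumℤ n f ≡ + 0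
sumℤ-zero zero    f≗0 = refl
sumℤ-zero (suc n) f≗0 = cong₂ ℤ._+_ (sumℤ-zero n f≗0) (f≗0 n)

sumℤ-+ : ∀ n (f g : ℕ → ℤ) → sumℤ n (λ j → f j ℤ.+ g j) ≡ sumℤ n f ℤ.+ sumℤ n g
sumℤ-+ zero    f g = refl
sumℤ-+ (suc n) f g = trans (cong (ℤ._+ (f n ℤ.+ g n)) (sumℤ-+ n f g))
  (ℤ+-interchange (sumℤ n f) (sumℤ n g) (f n) (g n))

sumℤ-*ˡ : ∀ n c (f : ℕ → ℤ) → sumℤ n (λ j → c ℤ.* f j) ≡ c ℤ.* sumℤ n f
sumℤ-*ˡ zero    c f = sym (ℤP.*-zeroʳ c)
sumℤ-*ˡ (suc n) c f = trans (cong (ℤ._+ c ℤ.* f n) (sumℤ-*ˡ n c f))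
  (sym (ℤP.*-distribˡ-+ c (sumℤ n f) (f n)))

sumℤ-unconsˡ : ∀ n (f : ℕ → ℤ) → sumℤ (suc n) f ≡ f 0 ℤ.+ sumℤ n (λ j → f (suc j))
sumℤ-unconsˡ zero    f = ℤP.+-comm (+ 0) (f 0)
sumℤ-unconsˡ (suc n) f = trans (cong (ℤ._+ f (suc n)) (sumℤ-unconsˡ n f))
  (ℤP.+-assoc (f 0) (sumℤ n (λ j → f (suc j))) (f (suc n)))

LatticeWeights : (ℕ → ℕ → ℕ → ℕ) → Set
LatticeWeights w = ∀ x x' y → w x x' y ≢ 0 → ∃ λ t → suc x ≡ x' + 2 * t

module _ (w : ℕ → ℕ → ℕ → ℕ) (lattice : LatticeWeights w) where

  Zw-support : ∀ N x → Zw w x N ≡ 0 ⊎ ∃ λ m → N ≡ x + 2 * m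
  Zw-support zero x with x ≟ 0
  ... | yes refl = inj₂ (0 , refl)
  ... | no _     = inj₁ refl
  Zw-support (suc N) x with Zw w x (suc N) ≟ 0
  ... | yes Z≡0 = inj₁ Z≡0
  ... | no Z≢0 with sumℕ-nonzero (suc N) (λ i → w i x N * Zw w i N) Z≢0
  ...   | i , _ , term≢0 with Zw-support N i
  ...     | inj₁ Zi≡0 = ⊥-elim (term≢0 (trans (cong (w i x N *_) Zi≡0) (*-zeroʳ (w i x N))))
  ...     | inj₂ (m , N≡i+2m) with lattice i x N (λ wi≡0 → term≢0 (cong (_* Zw w i N) wi≡0))
  ...       | t , 1+i≡x+2t = inj₂ (t + m , (begin
    suc N             ≡⟨ cong suc N≡i+2m ⟩
    suc i + 2 * m     ≡⟨ cong (_+ 2 * m) 1+i≡x+2t ⟩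
    x + 2 * t + 2 * m ≡⟨ +-assoc x (2 * t) (2 * m) ⟩
    x + (2 * t + 2 * m) ≡⟨ cong (λ u → x + u) (*-distribˡ-+ 2 t m) ⟨
    x + 2 * (t + m)   ∎))
    where open ≡-Reasoning

  Zw-above : ∀ {N x} → N < x → Zw w x N ≡ 0
  Zw-above {N} {x} N<x with Zw-support N x
  ... | inj₁ Z≡0         = Z≡0
  ... | inj₂ (m , N≡x+2m) = ⊥-elim (<⇒≱ N<x (subst (x ≤_) (sym N≡x+2m) (m≤m+n x (2 * m))))

  Zw-local : ∀ M N c s e → M < s →
    (∀ x → w x M N ≡ [ x == suc M ] * c + [ suc x == M ] + [ x == s ] * e) →
    Zw w M (suc N) ≡ c * Zw w (suc M) N + atPred (λ x → Zw w x N) M + e * Zw w s N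
  Zw-local M N c s e M<s w≡ = begin
    sumℕ (suc N) step
      ≡⟨ sumℕ-support (suc N) (suc s) step
           (λ x N<x → trans (cong (w x M N *_) (Zw-above N<x)) (*-zeroʳ (w x M N)))
           (λ x s<x → cong (_* Z x) (w-beyond x s<x)) ⟩
    sumℕ (suc s) step
      ≡⟨ sumℕ-cong (suc s) (λ x _ → split x) ⟩
    sumℕ (suc s) (λ x → right x + left x + long x)
      ≡⟨ trans (sumℕ-+ (suc s) _ long) (cong (_+ sumℕ (suc s) long) (sumℕ-+ (suc s) right left)) ⟩
    sumℕ (suc s) right + sumℕ (suc s) left + sumℕ (suc s) long
      ≡⟨ cong₂ _+_ (cong₂ _+_ (sumℕ-[==]* (suc s) (suc M) (λ _ → c * Z (suc M)) (s≤s M<s))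
                              (sumℕ-[suc==]* (suc s) M Z (≤-trans (<⇒≤ M<s) (n≤1+n s))))
                   (sumℕ-[==]* (suc s) s (λ _ → e * Z s) ≤-refl) ⟩
    c * Z (suc M) + atPred Z M + e * Z s ∎
    where
    open ≡-Reasoning
    Z step right left long : ℕ → ℕ
    Z x     = Zw w x N
    step x  = w x M N * Z x
    right x = [ x == suc M ] * (c * Z (suc M))
    left x  = [ suc x == M ] * Z x
    long x  = [ x == s ] * (e * Z s)
    w-beyond : ∀ x → suc s ≤ x → w x M N ≡ 0
    w-beyond x s<x = trans (w≡ x) (cong₂ _+_
      (cong₂ _+_ (cong (_* c) (≢⇒[==]≡0 (λ x≡1+M → <-irrefl (sym x≡1+M) (≤-<-trans M<s s<x))))
                 (≢⇒[==]≡0 (λ 1+x≡M → <-irrefl (sym 1+x≡M) (<-trans (<-trans M<s s<x) (n<1+n x)))))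
      (cong (_* e) (≢⇒[==]≡0 (λ x≡s → <-irrefl (sym x≡s) s<x))))
    distrib : ∀ i c j k e z → (i * c + j + k * e) * z ≡ i * (c * z) + j * z + k * (e * z)
    distrib = solve-∀
    split : ∀ x → step x ≡ right x + left x + long x
    split x = trans (cong (_* Z x) (w≡ x)) (trans (distrib [ x == suc M ] c [ suc x == M ] [ x == s ] e (Z x))
      (cong₂ _+_ (cong (_+ left x) ([==]*-subst x (suc M) (λ y → c * Z y))) ([==]*-subst x s (λ y → e * Z y))))

_C⁻_ : ℕ → ℕ → ℕ
n C⁻ zero  = 0
n C⁻ suc j = n C j

C-pascal : ∀ n j → suc n C j ≡ n C⁻ j + n C j
C-pascal n zero    = refl
C-pascal n (suc j) = sym (nCk+nC[k+1]≡[n+1]C[k+1] n j)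

F-at : ∀ m j {n} → m + 2 * j ≡ n → F (m + 2 * j) m ≡ + (n C j) ℤ.- + (n C⁻ j)
F-at m j refl with m ≤? m + 2 * j | 2 ∣? (m + 2 * j ∸ m)
... | yes _ | yes _ =
  trans (cong (λ h → binomℤ (m + 2 * j) (+ h) ℤ.- binomℤ (m + 2 * j) (+ h ℤ.- + 1)) half)
        (cong (λ b → + ((m + 2 * j) C j) ℤ.- b) (binomℤ-pred j))
  where
  half : (m + 2 * j ∸ m) / 2 ≡ j
  half = trans (cong (_/ 2) (trans (m+n∸m≡n m (2 * j)) (*-comm 2 j))) (m*n/n≡m j 2)
  binomℤ-pred : ∀ i → binomℤ (m + 2 * j) (+ i ℤ.- + 1) ≡ + ((m + 2 * j) C⁻ i)
  binomℤ-pred zero    = refl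
  binomℤ-pred (suc i) = refl
... | no m≰ | _     = ⊥-elim (m≰ (m≤m+n m (2 * j)))
... | yes _ | no 2∤ = ⊥-elim (2∤ (divides j (trans (m+n∸m≡n m (2 * j)) (*-comm 2 j))))

F-pascal : ∀ m i →
  F (suc m + 2 * suc i) (suc m) ≡ F (m + 2 * suc i) m ℤ.+ F (suc (suc m) + 2 * i) (suc (suc m))
F-pascal m i = begin
  F (suc m + 2 * suc i) (suc m)                ≡⟨ F-at (suc m) (suc i) (size m i) ⟩
  + (suc n C suc i) ℤ.- + (suc n C i)
    ≡⟨ cong₂ (λ u v → + u ℤ.- + v) (C-pascal n (suc i)) (C-pascal n i) ⟩
  + (n C i + n C suc i) ℤ.- + (n C⁻ i + n C i) ≡⟨ regroup (n C i) (n C suc i) (n C⁻ i) ⟩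
  (+ (n C suc i) ℤ.- + (n C i)) ℤ.+ (+ (n C i) ℤ.- + (n C⁻ i))
    ≡⟨ cong₂ ℤ._+_ (F-at m (suc i) (cong pred (size m i))) (F-at (suc (suc m)) i refl) ⟨
  F (m + 2 * suc i) m ℤ.+ F (suc (suc m) + 2 * i) (suc (suc m)) ∎
  where
  open ≡-Reasoning
  n : ℕ
  n = suc (suc m) + 2 * i
  size : ∀ m i → suc m + 2 * suc i ≡ suc (suc (suc m) + 2 * i)
  size = solve-∀
  regroup : ∀ A B c → + (A + B) ℤ.- + (c + A) ≡ (+ B ℤ.- + A) ℤ.+ (+ A ℤ.- + c)
  regroup A B c = trans (cong₂ ℤ._-_ (ℤP.pos-+ A B) (ℤP.pos-+ c A)) (ring (+ A) (+ B) (+ c))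
    where
    ring : ∀ A B c → (A ℤ.+ B) ℤ.- (c ℤ.+ A) ≡ (B ℤ.- A) ℤ.+ (A ℤ.- c)
    ring = ℤ-solve-∀

F-pascal-0 : ∀ i → F (2 * suc i) 0 ≡ F (1 + 2 * i) 1
F-pascal-0 i = begin
  F (2 * suc i) 0                              ≡⟨ F-at 0 (suc i) (size i) ⟩
  + (suc n C suc i) ℤ.- + (suc n C i)
    ≡⟨ cong₂ (λ u v → + u ℤ.- + v) (C-pascal n (suc i)) (C-pascal n i) ⟩
  + (n C i + n C suc i) ℤ.- + (n C⁻ i + n C i)
    ≡⟨ cong (λ u → + (n C i + u) ℤ.- + (n C⁻ i + n C i)) middle ⟩
  + (n C i + n C i) ℤ.- + (n C⁻ i + n C i)     ≡⟨ cancel (n C i) (n C⁻ i) ⟩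
  + (n C i) ℤ.- + (n C⁻ i)                     ≡⟨ F-at 1 i refl ⟨
  F (1 + 2 * i) 1                              ∎
  where
  open ≡-Reasoning
  n : ℕ
  n = 1 + 2 * i
  size : ∀ i → 2 * suc i ≡ suc (1 + 2 * i)
  size = solve-∀
  middle : n C suc i ≡ n C i
  middle = trans (nCk≡nC[n∸k] (s≤s (m≤m+n i (i + 0))))
                 (cong (n C_) (trans (m+n∸m≡n i (i + 0)) (+-identityʳ i)))
  cancel : ∀ A c → + (A + A) ℤ.- + (c + A) ≡ + A ℤ.- + c
  cancel A c = trans (cong₂ ℤ._-_ (ℤP.pos-+ A A) (ℤP.pos-+ c A)) (ring (+ A) (+ c))
    where
    ring : ∀ A c → (A ℤ.+ A) ℤ.- (c ℤ.+ A) ≡ A ℤ.- c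
    ring = ℤ-solve-∀

m≡n+k⇒m∸k≡n : ∀ {m n} k → m ≡ n + k → m ∸ k ≡ n
m≡n+k⇒m∸k≡n {n = n} k refl = m+n∸n≡m n k

module Model (a : ℕ) where

  l : ℕ
  l = suc (suc a)

  leftWeightOf : Bool → Bool → ℕ
  leftWeightOf true  _     = 0
  leftWeightOf false true  = 2
  leftWeightOf false false = 1

  -- the weight of the step y + 1 → y of the auxiliary model
  leftWeight : ℕ → ℕ
  leftWeight y = leftWeightOf (isYes (l ∣? suc (suc y))) (isYes (l ∣? suc y))

  wAux-suc : ∀ x x' y → wAux l (suc x) x' y ≡ [ x' == suc (suc x) ] + leftWeight x * [ x' == x ]
  wAux-suc x x' y = branches (isYes (l ∣? suc (suc x))) (isYes (l ∣? suc x)) _ _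
    where
    branches : ∀ b₁ b₂ P Q →
      (if b₁ then P else if b₂ then P + 2 * Q else P + Q) ≡ P + leftWeightOf b₁ b₂ * Q
    branches true  _     P Q = sym (+-identityʳ P)
    branches false true  P Q = refl
    branches false false P Q = cong (λ q → P + q) (sym (+-identityʳ Q))

  wAux-into : ∀ x M y → wAux l x M y ≡ [ x == suc M ] * leftWeight M + [ suc x == M ]
  wAux-into zero    M y = [==]-sym M 1
  wAux-into (suc x) M y = begin
    wAux l (suc x) M y                         ≡⟨ wAux-suc x M y ⟩
    [ M == suc (suc x) ] + leftWeight x * [ M == x ] ≡⟨ +-comm _ (leftWeight x * [ M == x ]) ⟩
    leftWeight x * [ M == x ] + [ M == suc (suc x) ]
      ≡⟨ cong₂ _+_ (*-comm (leftWeight x) _) ([==]-sym M (suc (suc x))) ⟩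
    [ M == x ] * leftWeight x + L                ≡⟨ cong (λ i → i * leftWeight x + L) ([==]-sym M x) ⟩
    [ x == M ] * leftWeight x + L                ≡⟨ cong (_+ L) ([==]*-subst x M leftWeight) ⟩
    [ x == M ] * leftWeight M + L
      ≡⟨ cong (λ i → i * leftWeight M + L) ([==]-resp {x} {M} (cong suc) suc-injective) ⟩
    [ suc x == suc M ] * leftWeight M + L        ∎
    where
    open ≡-Reasoning
    L = [ suc (suc x) == M ]

  -- d k = (k + 1) l - 1 is the left end of a filter; the long step into d k starts at
  -- d k + longSpan = (k + 3) l - 2 (the long step the statement indexes by k + 1).
  d : ℕ → ℕ
  d k = l * suc k ∸ 1

  longSpan : ℕ
  longSpan = l + suc a

  d-suc : ∀ k → d (suc k) ≡ d k + l
  d-suc k = ring a k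
    where
    ring : ∀ a k → suc k + suc a * suc (suc k) ≡ k + suc a * suc k + suc (suc a)
    ring = solve-∀

  d-injective : ∀ {k k'} → d k ≡ d k' → k ≡ k'
  d-injective {k} {k'} eq = suc-injective (*-cancelˡ-≡ (suc k) (suc k') l (cong suc eq))

  d-mono : ∀ {k k'} → k ≤ k' → d k ≤ d k'
  d-mono k≤k' = ≤-pred (*-monoʳ-≤ l (s≤s k≤k'))

  a<d : ∀ k → a < d k
  a<d k = ≤-trans (m≤m*n (suc a) (suc k)) (m≤n+m _ k)

  l∣1+d : ∀ k → l ∣ suc (d k)
  l∣1+d k = m∣m*n (suc k)

  d-after-band : ∀ k → suc (d k + suc a) ≡ d (suc k)
  d-after-band k = sym (trans (d-suc k) (+-suc (d k) (suc a)))

  d-source : ∀ k → l * (suc k + 2) ∸ 2 ≡ d k + longSpan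
  d-source k = m≡n+k⇒m∸k≡n 2 (ring a k)
    where
    ring : ∀ a k → suc (suc a) * (suc k + 2) ≡ k + suc a * suc k + (suc (suc a) + suc a) + 2
    ring = solve-∀

  d-height : ∀ k → l * suc k ∸ 2 + 2 * l ≡ d k + longSpan
  d-height k = trans (cong (_+ 2 * l) (m≡n+k⇒m∸k≡n 2 (ring₁ a k))) (ring₂ a k)
    where
    ring₁ : ∀ a k → suc (suc a) * suc k ≡ k + a * suc k + k + 2
    ring₁ = solve-∀
    ring₂ : ∀ a k → k + a * suc k + k + 2 * suc (suc a) ≡ k + suc a * suc k + (suc (suc a) + suc a)
    ring₂ = solve-∀

  <d0⇒≢d : ∀ {X} → X < d 0 → ∀ k → X ≢ d k
  <d0⇒≢d X<d0 k X≡dk = <-irrefl X≡dk (<-≤-trans X<d0 (d-mono z≤n))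

  inside-filters⇒≢d : ∀ {k X} → d k < X → X < d (suc k) → ∀ k' → X ≢ d k'
  inside-filters⇒≢d {k} dk<X X<d1+k k' X≡dk' with <-cmp k' k
  ... | tri< k'<k _ _ = <⇒≱ (subst (d k <_) X≡dk' dk<X) (d-mono (<⇒≤ k'<k))
  ... | tri≈ _ refl _ = <-irrefl (sym X≡dk') dk<X
  ... | tri> _ _ k<k' = <⇒≱ (subst (_< d (suc k)) X≡dk' X<d1+k) (d-mono k<k')

  longSource : ℕ → ℕ → ℕ → ℕ → ℕ
  longSource x y k m = [ x == l * (suc k + 2) ∸ 2 ] * [ y == l * suc k ∸ 2 + 2 * m ]

  wLong-into-≢d : ∀ x M y → (∀ k → M ≢ d k) → wLong l x M y ≡ 0
  wLong-into-≢d x M y M≢d = sumℕ-zero x (λ k → sumℕ-zero (suc y) (λ m →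
    trans (cong (longSource x y k m *_) (≢⇒[==]≡0 (M≢d k))) (*-zeroʳ (longSource x y k m))))

  wLong-source : ∀ x M y → wLong l x M y ≡ [ x == M + longSpan ] * wLong l (M + longSpan) M y
  wLong-source x M y with x ≟ M + longSpan
  ... | yes refl = sym (+-identityʳ _)
  ... | no x≢src = sumℕ-zero x (λ k → sumℕ-zero (suc y) (λ m → term k m))
    where
    term : ∀ k m → longSource x y k m * [ M == d k ] ≡ 0
    term k m with M ≟ d k
    ... | yes refl = cong (λ i → i * [ y == l * suc k ∸ 2 + 2 * m ] * 1)
                       (≢⇒[==]≡0 (λ x≡src → x≢src (trans x≡src (d-source k))))
    ... | no _     = *-zeroʳ (longSource x y k m)

  wLong-d : ∀ k N t → N ≡ d k + longSpan + 2 * t → wLong l (d k + longSpan) (d k) N ≡ 1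
  wLong-d k N t N≡ = trans (sumℕ-cong (d k + longSpan) (λ k' _ → levels k'))
                           (sumℕ-[==]* (d k + longSpan) k (λ _ → 1) k<src)
    where
    src = d k + longSpan
    base = l * suc k ∸ 2
    m₀ = t + l
    N≡base+2m₀ : N ≡ base + 2 * m₀
    N≡base+2m₀ = trans N≡ (trans (cong (_+ 2 * t) (sym (d-height k))) (ring base t l))
      where
      ring : ∀ b t l → b + 2 * l + 2 * t ≡ b + 2 * (t + l)
      ring = solve-∀
    m₀≤N : m₀ < suc N
    m₀≤N = s≤s (subst (m₀ ≤_) (sym N≡base+2m₀) (≤-trans (m≤m+n m₀ (m₀ + 0)) (m≤n+m (2 * m₀) base)))
    k<src : k < src
    k<src = ≤-trans (s≤s (m≤m+n k _)) (subst (suc (d k) ≤_) (sym (+-suc (d k) _)) (s≤s (m≤m+n _ _)))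
    height : ∀ m → [ N == base + 2 * m ] ≡ [ m == m₀ ] * 1
    height m with m ≟ m₀
    ... | yes refl = ≡⇒[==]≡1 N≡base+2m₀
    ... | no m≢m₀  = ≢⇒[==]≡0 (λ N≡ → m≢m₀ (*-cancelˡ-≡ m m₀ 2
                       (+-cancelˡ-≡ base _ _ (trans (sym N≡) N≡base+2m₀))))
    levels : ∀ k' → sumℕ (suc N) (λ m → longSource src N k' m * [ d k == d k' ]) ≡ [ k' == k ] * 1
    levels k' with k' ≟ k
    ... | no k'≢k = sumℕ-zero (suc N) (λ m →
          trans (cong (longSource src N k' m *_) (≢⇒[==]≡0 (λ dk≡dk' → k'≢k (sym (d-injective dk≡dk')))))
                (*-zeroʳ (longSource src N k' m)))
    ... | yes refl = trans (sumℕ-cong (suc N) (λ m _ →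
          trans (cong₂ (λ i j → i * [ N == base + 2 * m ] * j)
                       (≡⇒[==]≡1 (sym (d-source k))) (≡⇒[==]≡1 refl))
                (trans (*-identityʳ _) (trans (+-identityʳ _) (height m)))))
          (sumℕ-[==]* (suc N) m₀ (λ _ → 1) m₀≤N)

  wAux-lattice : LatticeWeights (wAux l)
  wAux-lattice x M y w≢0 with x ≟ suc M | suc x ≟ M
  ... | yes refl | _        = 1 , +-comm 2 M
  ... | no _     | yes refl = 0 , sym (+-identityʳ (suc x))
  ... | no x≢1+M  | no 1+x≢M = ⊥-elim (w≢0 (trans (wAux-into x M y)
    (cong₂ (λ i j → i * leftWeight M + j) (≢⇒[==]≡0 x≢1+M) (≢⇒[==]≡0 1+x≢M))))

  wLong-lattice : LatticeWeights (wLong l)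
  wLong-lattice x M y w≢0 with x ≟ M + longSpan
  ... | yes refl = l , ring a M
    where
    ring : ∀ a M → suc (M + (suc (suc a) + suc a)) ≡ M + 2 * suc (suc a)
    ring = solve-∀
  ... | no x≢src = ⊥-elim (w≢0 (trans (wLong-source x M y)
                                      (cong (_* wLong l (M + longSpan) M y) (≢⇒[==]≡0 x≢src))))

  wU-lattice : LatticeWeights (wU l)
  wU-lattice x M y w≢0 with wAux l x M y ≟ 0
  ... | no aux≢0 = wAux-lattice x M y aux≢0
  ... | yes aux≡0 = wLong-lattice x M y (λ long≡0 → w≢0 (cong₂ _+_ aux≡0 long≡0))

  wU-into : ∀ x M y → wU l x M y ≡
    [ x == suc M ] * leftWeight M + [ suc x == M ] + [ x == M + longSpan ] * wLong l (M + longSpan) M y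
  wU-into x M y = cong₂ _+_ (wAux-into x M y) (wLong-source x M y)

  Zaux-rec : ∀ M N → Zaux l M (suc N) ≡ leftWeight M * Zaux l (suc M) N + atPred (λ x → Zaux l x N) M
  Zaux-rec M N = trans
    (Zw-local (wAux l) wAux-lattice M N (leftWeight M) (suc M) 0 (n<1+n M) (λ x →
      trans (wAux-into x M N) (sym (trans (cong (λ z → [ x == suc M ] * leftWeight M + [ suc x == M ] + z)
                                                  (*-zeroʳ [ x == suc M ]))
                                            (+-identityʳ _)))))
    (+-identityʳ _)

  ZU-rec : ∀ M N → ZU l M (suc N) ≡
    leftWeight M * ZU l (suc M) N + atPred (λ x → ZU l x N) M + wLong l (M + longSpan) M N * ZU l (M + longSpan) N
  ZU-rec M N = Zw-local (wU l) wU-lattice M N (leftWeight M) (M + longSpan) (wLong l (M + longSpan) M N)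
    (m<m+n M 0<1+n) (λ x → wU-into x M N)

  longStep-d : ∀ k N → wLong l (d k + longSpan) (d k) N * ZU l (d k + longSpan) N ≡ ZU l (d k + longSpan) N
  longStep-d k N with Zw-support (wU l) wU-lattice N (d k + longSpan)
  ... | inj₁ Z≡0      = trans (cong (W *_) Z≡0) (trans (*-zeroʳ W) (sym Z≡0))
    where W = wLong l (d k + longSpan) (d k) N
  ... | inj₂ (t , N≡) = trans (cong (_* ZU l (d k + longSpan) N) (wLong-d k N t N≡)) (+-identityʳ _)

  isYes-l∣?-periodic : ∀ n c → l ∣ c → isYes (l ∣? (n + c)) ≡ isYes (l ∣? n)
  isYes-l∣?-periodic n c l∣c with l ∣? n
  ... | yes l∣n = isYes-true (l ∣? (n + c)) (∣m∣n⇒∣m+n l∣n l∣c)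
  ... | no l∤n  =
    isYes-false (l ∣? (n + c)) (λ l∣n+c → l∤n (∣m+n∣m⇒∣n (subst (l ∣_) (+-comm n c) l∣n+c) l∣c))

  leftWeight-periodic : ∀ y c → l ∣ c → leftWeight (y + c) ≡ leftWeight y
  leftWeight-periodic y c l∣c =
    cong₂ leftWeightOf (isYes-l∣?-periodic (suc (suc y)) c l∣c) (isYes-l∣?-periodic (suc y) c l∣c)

  leftWeight-wall : ∀ y → l ∣ suc (suc y) → leftWeight y ≡ 0
  leftWeight-wall y l∣2+y =
    cong (λ b → leftWeightOf b (isYes (l ∣? suc y))) (isYes-true (l ∣? suc (suc y)) l∣2+y)

  leftWeight-filter : ∀ y → l ∣ suc y → leftWeight y ≡ 2
  leftWeight-filter y l∣1+y =
    cong₂ leftWeightOf (isYes-false (l ∣? suc (suc y)) l∤2+y) (isYes-true (l ∣? suc y) l∣1+y)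
    where
    l∤2+y : ¬ l ∣ suc (suc y)
    l∤2+y l∣2+y with ∣1⇒≡1 (∣m+n∣m⇒∣n (subst (l ∣_) (+-comm 1 (suc y)) l∣2+y) l∣1+y)
    ... | ()

  ZU≡Zaux-before-filters : ∀ N M → M ≤ a → ZU l M N ≡ Zaux l M N
  ZU≡Zaux-before-filters zero    M _   = refl
  ZU≡Zaux-before-filters (suc N) M M≤a = begin
    ZU l M (suc N)
      ≡⟨ ZU-rec M N ⟩
    leftWeight M * ZU l (suc M) N + atPred (λ x → ZU l x N) M + wLong l (M + longSpan) M N * ZU l (M + longSpan) N
      ≡⟨ cong₂ _+_ (cong₂ _+_ (fromRight M≤a) (fromLeft M M≤a))
                   (cong (_* ZU l (M + longSpan) N)
                         (wLong-into-≢d (M + longSpan) M N (<d0⇒≢d (≤-<-trans M≤a (a<d 0))))) ⟩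
    leftWeight M * Zaux l (suc M) N + atPred (λ x → Zaux l x N) M + 0
      ≡⟨ +-identityʳ _ ⟩
    leftWeight M * Zaux l (suc M) N + atPred (λ x → Zaux l x N) M
      ≡⟨ Zaux-rec M N ⟨
    Zaux l M (suc N) ∎
    where
    open ≡-Reasoning
    IH : ∀ M → M ≤ a → ZU l M N ≡ Zaux l M N
    IH = ZU≡Zaux-before-filters N
    fromRight : M ≤ a → leftWeight M * ZU l (suc M) N ≡ leftWeight M * Zaux l (suc M) N
    fromRight M≤a with m≤n⇒m<n∨m≡n M≤a
    ... | inj₁ M<a  = cong (leftWeight M *_) (IH (suc M) M<a)
    ... | inj₂ refl = trans (cong (_* ZU l (suc a) N) wall) (cong (_* Zaux l (suc a) N) (sym wall))
      where
      wall : leftWeight a ≡ 0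
      wall = leftWeight-wall a (∣-refl {l})
    fromLeft : ∀ M → M ≤ a → atPred (λ x → ZU l x N) M ≡ atPred (λ x → Zaux l x N) M
    fromLeft zero     _   = refl
    fromLeft (suc M') M≤a = IH M' (≤-trans (n≤1+n M') M≤a)

  -- ballotSum (k - 1) M N J is the right-hand side of the theorem cut off after J terms.
  ballotSum : ℕ → ℕ → ℕ → ℕ → ℤ
  ballotSum m M N J = sumℤ J (λ j → F (m + 2 * j) m ℤ.* + Zaux l (M + 2 * j * l) N)

  ballotSum-rec : ∀ m M N J → ballotSum m (suc M) (suc N) J ≡
    + leftWeight (suc M) ℤ.* ballotSum m (suc (suc M)) N J ℤ.+ ballotSum m M N J
  ballotSum-rec m M N J = trans (sumℤ-cong J (λ j _ → term j))
    (trans (sumℤ-+ J _ _) (cong (ℤ._+ ballotSum m M N J) (sumℤ-*ˡ J (+ c) _)))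
    where
    c = leftWeight (suc M)
    term : ∀ j → F (m + 2 * j) m ℤ.* + Zaux l (suc M + 2 * j * l) (suc N) ≡
      + c ℤ.* (F (m + 2 * j) m ℤ.* + Zaux l (suc (suc M) + 2 * j * l) N)
        ℤ.+ F (m + 2 * j) m ℤ.* + Zaux l (M + 2 * j * l) N
    term j = begin
      f ℤ.* + Zaux l (suc M + 2 * j * l) (suc N)
        ≡⟨ cong (λ z → f ℤ.* + z) (Zaux-rec (suc M + 2 * j * l) N) ⟩
      f ℤ.* + (leftWeight (suc M + 2 * j * l) * Z₂ + Z₀)
        ≡⟨ cong (λ c' → f ℤ.* + (c' * Z₂ + Z₀))
                (leftWeight-periodic (suc M) (2 * j * l) (n∣m*n (2 * j))) ⟩
      f ℤ.* + (c * Z₂ + Z₀)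
        ≡⟨ cong (f ℤ.*_) (trans (ℤP.pos-+ (c * Z₂) Z₀) (cong (ℤ._+ + Z₀) (ℤP.pos-* c Z₂))) ⟩
      f ℤ.* (+ c ℤ.* + Z₂ ℤ.+ + Z₀)
        ≡⟨ ring f (+ c) (+ Z₂) (+ Z₀) ⟩
      + c ℤ.* (f ℤ.* + Z₂) ℤ.+ f ℤ.* + Z₀ ∎
      where
      open ≡-Reasoning
      f = F (m + 2 * j) m
      Z₂ = Zaux l (suc (suc M) + 2 * j * l) N
      Z₀ = Zaux l (M + 2 * j * l) N
      ring : ∀ f c x y → f ℤ.* (c ℤ.* x ℤ.+ y) ≡ c ℤ.* (f ℤ.* x) ℤ.+ f ℤ.* y
      ring = ℤ-solve-∀

  ballotSum-above : ∀ m M N J → N < M → ballotSum m M N J ≡ + 0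
  ballotSum-above m M N J N<M = sumℤ-zero J (λ j →
    trans (cong (λ z → F (m + 2 * j) m ℤ.* + z)
                (Zw-above (wAux l) wAux-lattice (<-≤-trans N<M (m≤m+n M (2 * j * l)))))
          (ℤP.*-zeroʳ (F (m + 2 * j) m)))

  shift-by-2l : ∀ M j → M + 2 * suc j * l ≡ suc M + longSpan + 2 * j * l
  shift-by-2l M j = ring M j a
    where
    ring : ∀ M j a → M + 2 * suc j * suc (suc a) ≡ suc M + (suc (suc a) + suc a) + 2 * j * suc (suc a)
    ring = solve-∀

  ballotSum-split : ∀ m M N J →
    ballotSum (suc m) M N (suc J) ≡ ballotSum m M N (suc J) ℤ.+ ballotSum (suc (suc m)) (suc M + longSpan) N J
  ballotSum-split m M N J = begin
    ballotSum (suc m) M N (suc J)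
      ≡⟨ sumℤ-unconsˡ J _ ⟩
    F (suc m + 2 * 0) (suc m) ℤ.* X 0 ℤ.+ sumℤ J (λ j → F (suc m + 2 * suc j) (suc m) ℤ.* X (suc j))
      ≡⟨ cong₂ ℤ._+_ (cong (ℤ._* X 0) (trans (F-at (suc m) 0 refl) (sym (F-at m 0 refl))))
                     (trans (sumℤ-cong J (λ j _ → trans (cong (ℤ._* X (suc j)) (F-pascal m j))
                                                        (ℤP.*-distribʳ-+ (X (suc j)) (A j) (B j))))
                            (sumℤ-+ J _ _)) ⟩
    A₀ ℤ.+ (sumℤ J (λ j → A j ℤ.* X (suc j)) ℤ.+ sumℤ J (λ j → B j ℤ.* X (suc j)))
      ≡⟨ ℤP.+-assoc A₀ _ _ ⟨
    (A₀ ℤ.+ sumℤ J (λ j → A j ℤ.* X (suc j))) ℤ.+ sumℤ J (λ j → B j ℤ.* X (suc j))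
      ≡⟨ cong₂ ℤ._+_ (sym (sumℤ-unconsˡ J _))
                     (sumℤ-cong J (λ j _ → cong (λ z → B j ℤ.* + Zaux l z N) (shift-by-2l M j))) ⟩
    ballotSum m M N (suc J) ℤ.+ ballotSum (suc (suc m)) (suc M + longSpan) N J ∎
    where
    open ≡-Reasoning
    X : ℕ → ℤ
    X j = + Zaux l (M + 2 * j * l) N
    A B : ℕ → ℤ
    A j = F (m + 2 * suc j) m
    B j = F (suc (suc m) + 2 * j) (suc (suc m))
    A₀ = F (m + 2 * 0) m ℤ.* X 0

  ballotSum-split-0 : ∀ M N J → ballotSum 0 M N (suc J) ≡ + Zaux l M N ℤ.+ ballotSum 1 (suc M + longSpan) N J
  ballotSum-split-0 M N J = trans (sumℤ-unconsˡ J _)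
    (cong₂ ℤ._+_ (trans (ℤP.*-identityˡ _) (cong (λ z → + Zaux l z N) (+-identityʳ M)))
                 (sumℤ-cong J (λ j _ →
                   cong₂ ℤ._*_ (F-pascal-0 j) (cong (λ z → + Zaux l z N) (shift-by-2l M j)))))

  BallotIdentity : ℕ → Set
  BallotIdentity N = ∀ k M J → d k ≤ M → M ≤ d k + suc a → N < M + 2 * J * l →
    + ZU l M N ≡ ballotSum k M N J

  ballot-below : ∀ k M N J → N < M → + ZU l M N ≡ ballotSum k M N J
  ballot-below k M N J N<M =
    trans (cong +_ (Zw-above (wU l) wU-lattice N<M)) (sym (ballotSum-above k M N J N<M))

  ballot-interior : ∀ {N} → BallotIdentity N → ∀ k M J → d k < suc M → suc M ≤ d k + suc a →
    N < M + 2 * J * l → + ZU l (suc M) (suc N) ≡ ballotSum k (suc M) (suc N) J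
  ballot-interior {N} IH k M J dk<1+M 1+M≤ bound = begin
    + ZU l (suc M) (suc N)
      ≡⟨ cong +_ (ZU-rec (suc M) N) ⟩
    + (c * Z₂ + ZU l M N + wLong l (suc M + longSpan) (suc M) N * ZU l (suc M + longSpan) N)
      ≡⟨ cong (λ w → + (c * Z₂ + ZU l M N + w * ZU l (suc M + longSpan) N))
              (wLong-into-≢d (suc M + longSpan) (suc M) N (inside-filters⇒≢d dk<1+M 1+M<d[1+k])) ⟩
    + (c * Z₂ + ZU l M N + 0)
      ≡⟨ cong +_ (+-identityʳ _) ⟩
    + (c * Z₂ + ZU l M N)
      ≡⟨ trans (ℤP.pos-+ (c * Z₂) (ZU l M N)) (cong (ℤ._+ + ZU l M N) (ℤP.pos-* c Z₂)) ⟩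
    + c ℤ.* + Z₂ ℤ.+ + ZU l M N
      ≡⟨ cong₂ ℤ._+_ fromRight (IH k M J (m<1+n⇒m≤n dk<1+M) (≤-trans (n≤1+n M) 1+M≤) bound) ⟩
    + c ℤ.* ballotSum k (suc (suc M)) N J ℤ.+ ballotSum k M N J
      ≡⟨ ballotSum-rec k M N J ⟨
    ballotSum k (suc M) (suc N) J ∎
    where
    open ≡-Reasoning
    c = leftWeight (suc M)
    Z₂ = ZU l (suc (suc M)) N
    1+M<d[1+k] : suc M < d (suc k)
    1+M<d[1+k] = subst (suc M <_) (d-after-band k) (s≤s 1+M≤)
    fromRight : + c ℤ.* + Z₂ ≡ + c ℤ.* ballotSum k (suc (suc M)) N J
    fromRight with suc (suc M) ≤? d k + suc a
    ... | yes 2+M≤ = cong (+ c ℤ.*_) (IH k (suc (suc M)) J (≤-trans (<⇒≤ dk<1+M) (n≤1+n _)) 2+M≤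
                                          (<-≤-trans bound (+-monoˡ-≤ _ (m≤n+m M 2))))
    ... | no 2+M≰ = trans (cong (λ c' → + c' ℤ.* + Z₂) c≡0)
                      (sym (cong (λ c' → + c' ℤ.* ballotSum k (suc (suc M)) N J) c≡0))
      where
      1+M≡ : suc M ≡ d k + suc a
      1+M≡ = ≤-antisym 1+M≤ (m<1+n⇒m≤n (≰⇒> 2+M≰))
      c≡0 : c ≡ 0
      c≡0 = leftWeight-wall (suc M)
              (subst (λ x → l ∣ suc x) (sym (trans (cong suc 1+M≡) (d-after-band k))) (l∣1+d (suc k)))

  ballot-left-of-filter : ∀ {N} → BallotIdentity N → ∀ k M J → suc M ≡ d k → N < M + 2 * suc J * l →
    ballotSum k M N (suc J) ≡ + ZU l M N ℤ.+ ballotSum (suc k) (suc M + longSpan) N J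
  ballot-left-of-filter {N} IH zero M J 1+M≡d0 bound = trans (ballotSum-split-0 M N J)
    (cong (ℤ._+ ballotSum 1 (suc M + longSpan) N J) (cong +_ (sym (ZU≡Zaux-before-filters N M M≤a))))
    where
    M≤a : M ≤ a
    M≤a = ≤-reflexive (trans (suc-injective 1+M≡d0) (*-identityʳ a))
  ballot-left-of-filter {N} IH (suc k) M J 1+M≡d[1+k] bound = trans (ballotSum-split k M N J)
    (cong (ℤ._+ ballotSum (suc (suc k)) (suc M + longSpan) N J)
          (sym (IH k M (suc J) (subst (d k ≤_) (sym M≡) (m≤m+n _ _)) (≤-reflexive M≡) bound)))
    where
    M≡ : M ≡ d k + suc a
    M≡ = suc-injective (trans 1+M≡d[1+k] (sym (d-after-band k)))

  ballot-filter : ∀ {N} → BallotIdentity N → ∀ k M J → suc M ≡ d k → N < M + 2 * suc J * l →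
    + ZU l (suc M) (suc N) ≡ ballotSum k (suc M) (suc N) (suc J)
  ballot-filter {N} IH k M J 1+M≡dk bound = begin
    + ZU l (suc M) (suc N)
      ≡⟨ cong +_ (ZU-rec (suc M) N) ⟩
    + (c * Z₂ + ZU l M N + wLong l (suc M + longSpan) (suc M) N * Zₛ)
      ≡⟨ cong₂ (λ c' z → + (c' * Z₂ + ZU l M N + z)) c≡2 longStep ⟩
    + (2 * Z₂ + ZU l M N + Zₛ)
      ≡⟨ toℤ Z₂ (ZU l M N) Zₛ ⟩
    + 2 ℤ.* + Z₂ ℤ.+ (+ ZU l M N ℤ.+ + Zₛ)
      ≡⟨ cong₂ (λ u v → + 2 ℤ.* u ℤ.+ (+ ZU l M N ℤ.+ v)) right long ⟩
    + 2 ℤ.* ballotSum k (suc (suc M)) N (suc J) ℤ.+ (+ ZU l M N ℤ.+ ballotSum (suc k) (suc M + longSpan) N J)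
      ≡⟨ cong₂ (λ c' z → + c' ℤ.* ballotSum k (suc (suc M)) N (suc J) ℤ.+ z)
               (sym c≡2) (sym (ballot-left-of-filter IH k M J 1+M≡dk bound)) ⟩
    + c ℤ.* ballotSum k (suc (suc M)) N (suc J) ℤ.+ ballotSum k M N (suc J)
      ≡⟨ ballotSum-rec k M N (suc J) ⟨
    ballotSum k (suc M) (suc N) (suc J) ∎
    where
    open ≡-Reasoning
    c = leftWeight (suc M)
    Z₂ = ZU l (suc (suc M)) N
    Zₛ = ZU l (suc M + longSpan) N
    c≡2 : c ≡ 2
    c≡2 = leftWeight-filter (suc M) (subst (λ x → l ∣ suc x) (sym 1+M≡dk) (l∣1+d k))
    longStep : wLong l (suc M + longSpan) (suc M) N * Zₛ ≡ Zₛ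
    longStep = subst (λ x → wLong l (x + longSpan) x N * ZU l (x + longSpan) N ≡ ZU l (x + longSpan) N)
                     (sym 1+M≡dk) (longStep-d k N)
    toℤ : ∀ x y z → + (2 * x + y + z) ≡ + 2 ℤ.* + x ℤ.+ (+ y ℤ.+ + z)
    toℤ x y z = trans (ℤP.pos-+ (2 * x + y) z)
      (trans (cong (ℤ._+ + z) (trans (ℤP.pos-+ (2 * x) y) (cong (ℤ._+ + y) (ℤP.pos-* 2 x))))
             (ℤP.+-assoc (+ 2 ℤ.* + x) (+ y) (+ z)))
    right : + Z₂ ≡ ballotSum k (suc (suc M)) N (suc J)
    right = IH k (suc (suc M)) (suc J) (subst (_≤ suc (suc M)) 1+M≡dk (n≤1+n (suc M)))
              (subst (λ x → suc x ≤ d k + suc a) (sym 1+M≡dk) (m<m+n (d k) z<s))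
              (<-≤-trans bound (+-monoˡ-≤ _ (m≤n+m M 2)))
    1+M+span≡ : suc M + longSpan ≡ d (suc k) + suc a
    1+M+span≡ = trans (cong (_+ longSpan) 1+M≡dk)
                      (trans (sym (+-assoc (d k) l (suc a))) (cong (_+ suc a) (sym (d-suc k))))
    long : + Zₛ ≡ ballotSum (suc k) (suc M + longSpan) N J
    long = IH (suc k) (suc M + longSpan) J (subst (d (suc k) ≤_) (sym 1+M+span≡) (m≤m+n _ _))
              (≤-reflexive 1+M+span≡) (subst (N <_) (shift-by-2l M J) bound)

  ballot-identity : ∀ N → BallotIdentity N
  ballot-identity N k zero J dk≤0 _ _ = ⊥-elim (n≮0 (<-≤-trans (a<d k) dk≤0))
  ballot-identity N k (suc M) J dk≤1+M 1+M≤ bound with N <? suc M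
  ... | yes N<1+M = ballot-below k (suc M) N J N<1+M
  ballot-identity zero k (suc M) J _ _ _ | no 0≮1+M = ⊥-elim (0≮1+M z<s)
  ballot-identity (suc N) k (suc M) zero _ _ bound | no 1+N≮1+M =
    ⊥-elim (1+N≮1+M (subst (suc N <_) (+-identityʳ (suc M)) bound))
  ballot-identity (suc N) k (suc M) (suc J) dk≤1+M 1+M≤ bound | no _ with suc M ≟ d k
  ... | yes 1+M≡dk = ballot-filter (ballot-identity N) k M J 1+M≡dk (≤-pred bound)
  ... | no 1+M≢dk  =
    ballot-interior (ballot-identity N) k M (suc J) (≤∧≢⇒< dk≤1+M (≢-sym 1+M≢dk)) 1+M≤ (≤-pred bound)

  d-right-end : ∀ k → l * (suc k + 1) ∸ 2 ≡ d k + suc a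
  d-right-end k = m≡n+k⇒m∸k≡n 2 (ring a k)
    where
    ring : ∀ a k → suc (suc a) * (suc k + 1) ≡ k + suc a * suc k + suc a + 2
    ring = solve-∀

  enough-terms : ∀ k M N → d k ≤ M → N < M + 2 * suc (floorDiv (N + 1 ∸ l * suc k) (2 * l)) * l
  enough-terms k M N dk≤M = subst (λ z → N < M + z) (ring q a) (≤-pred (begin-strict
    suc N                       ≡⟨ +-comm 1 N ⟩
    N + 1                       ≤⟨ m≤n+m∸n (N + 1) (l * suc k) ⟩
    l * suc k + x               <⟨ +-monoʳ-< (l * suc k) x<[1+q]*2l ⟩
    l * suc k + suc q * (2 * l) ≤⟨ +-monoˡ-≤ (suc q * (2 * l)) (s≤s dk≤M) ⟩
    suc M + suc q * (2 * l)     ∎))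
    where
    open ≤-Reasoning
    x = N + 1 ∸ l * suc k
    q = x / (2 * l)
    x<[1+q]*2l : x < suc q * (2 * l)
    x<[1+q]*2l = subst (_< suc q * (2 * l)) (sym (m≡m%n+[m/n]*n x (2 * l)))
                       (+-monoˡ-< (q * (2 * l)) (m%n<n x (2 * l)))
    ring : ∀ q a → suc q * (2 * suc (suc a)) ≡ 2 * suc q * suc (suc a)
    ring = solve-∀

lemma6p1 : (l : ℕ) → 2 ≤ l →
    ((M N : ℕ) → 2 ∣ (M + N) → M ≤ l ∸ 2 → ZU l M N ≡ Zaux l M N)
    ×
    ((k M N : ℕ) → 1 ≤ k → 2 ∣ (M + N) → l * k ∸ 1 ≤ M → M ≤ l * (k + 1) ∸ 2 →
      + ZU l M N ≡
        sumℤ (suc (floorDiv (N + 1 ∸ l * k) (2 * l)))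
          (λ j → F (k ∸ 1 + 2 * j) (k ∸ 1) ℤ.* + Zaux l (M + 2 * j * l) N))
lemma6p1 (suc zero)    (s≤s ())
lemma6p1 (suc (suc a)) _ = before-filters , between-filters
  where
  open Model a
  before-filters : (M N : ℕ) → 2 ∣ (M + N) → M ≤ a → ZU l M N ≡ Zaux l M N
  before-filters M N _ M≤a = ZU≡Zaux-before-filters N M M≤a
  between-filters : (k M N : ℕ) → 1 ≤ k → 2 ∣ (M + N) → l * k ∸ 1 ≤ M → M ≤ l * (k + 1) ∸ 2 →
    + ZU l M N ≡ ballotSum (k ∸ 1) M N (suc (floorDiv (N + 1 ∸ l * k) (2 * l)))
  between-filters (suc k) M N _ _ dk≤M M≤ =
    ballot-identity N k M (suc (floorDiv (N + 1 ∸ l * suc k) (2 * l)))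
      dk≤M (subst (M ≤_) (d-right-end k) M≤) (enough-terms k M N dk≤M)
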